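{- There exist positive constants $c, C$ such that for every integer $n>3$, \[ c\log_2 n\le \chi\big(J_\pm(n,3,-1)\big)\le C\log_2 n, \] where $J_\pm(n,3,-1)$ is the graph whose vertex set consists of all vectors $v\in\{ -1,0,1\}^n$ with exactly $3$ nonzero coordinates, two vertices being adjacent if and only if their standard scalar product equals $-1$.
   Context: $\chi(G)$ denotes the chromatic number of $G$: the minimum number of colors in a coloring of the vertices such that adjacent vertices receive different colors. -}

module Defs where

open import Data.Nat using (ℕ; zero; suc; _+_; _≤_)
open import Data.Integer as ℤ using (ℤ; 0ℤ; 1ℤ; -1ℤ)
open import Data.Fin using (Fin)
open import Data.Vec using (Vec; []; _∷_)
open import Data.Vec.Relation.Unary.All using (All)
open import Data.Product using (Σ; _×_; proj₁)
open import Data.Sum using (_⊎_)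
open import Relation.Binary.PropositionalEquality using (_≡_; _≢_)
open import Relation.Nullary using (¬_)
open import Relation.Nullary.Decidable using (does)
open import Data.Bool using (if_then_else_)

record Graph : Set₁ where
  field
    V   : Set
    Adj : V → V → Set
open Graph public

Colouring : Graph → ℕ → Set
Colouring G k = Σ (V G → Fin k) λ f → ∀ u v → Adj G u v → f u ≢ f v

Colourable : Graph → ℕ → Set
Colourable G k = Colouring G k

IsChromaticNumber : Graph → ℕ → Set
IsChromaticNumber G k = Colourable G k × (∀ m → Colourable G m → k ≤ m)

dot : ∀ {n} → Vec ℤ n → Vec ℤ n → ℤ
dot []       []       = 0ℤ
dot (x ∷ xs) (y ∷ ys) = x ℤ.* y ℤ.+ dot xs ys

nnz : ∀ {n} → Vec ℤ n → ℕ
nnz []       = 0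
nnz (x ∷ xs) = (if does (x ℤ.≟ 0ℤ) then 0 else 1) + nnz xs

Ternary : ℤ → Set
Ternary x = x ≡ -1ℤ ⊎ x ≡ 0ℤ ⊎ x ≡ 1ℤ

JVertex : ℕ → Set
JVertex n = Σ (Vec ℤ n) λ v → All Ternary v × nnz v ≡ 3

J± : ℕ → Graph
J± n = record { V = JVertex n ; Adj = λ u v → dot (proj₁ u) (proj₁ v) ≡ -1ℤ }

-- Upper bound: read h ∈ Boolⁿ as a sign vector. Vertices whose nonzero entries all carry the
-- signs prescribed by h have coordinatewise nonnegative products, hence scalar product ≥ 0 ≠ −1,
-- so each h spans an independent set. A vertex of weight 3 agrees with exactly 1/8 of all h, so by
-- double counting some h covers an eighth of any set of vertices, and greedily O(log n) sign
-- vectors cover all of the at most (2n)³ vertices.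
-- Lower bound: write n = 2m + r. The vertices x_ij = e_i − e_j + e_{m+j} (i < j < m) satisfy
-- x_ij · x_jl = −1, so J±(n,3,−1) contains the shift graph on m points. In a proper colouring the
-- colour of x_ij occurs on the edges leaving i but not on those leaving j, so sending i to the set
-- of colours on its outgoing edges is injective and m ≤ 2^χ.

module Submission where

open import Defs
open import Data.Bool using (Bool; true; false; not; _∧_; T; if_then_else_)
open import Data.Bool.Properties using (T-∧)
open import Function.Bundles using (Equivalence)
open import Data.Nat using (ℕ; zero; suc; _+_; _*_; _^_; _≤_; _<_; z≤n; s≤s; z<s; _≤?_; _<?_)
open import Data.Nat.Properties
open import Data.List as List using (List; []; _∷_; _++_; map; length; filter)
open import Data.List.Properties using (length-++; length-map)
open import Data.List.Relation.Unary.All as All using (All; []; _∷_)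
open import Data.List.Relation.Unary.All.Properties using (filter⁺; map⁺; ++⁺)
open import Data.List.Relation.Unary.Any using (Any; here; there; index)
open import Data.List.Relation.Unary.Any.Properties using (lookup-index)
open import Data.Fin as Fin using (Fin; zero; suc; _↑ˡ_; finToFun; funToFin)
open import Data.Fin.Properties as Finₚ using (injective⇒≤; any?; finToFun-funToFin)
open import Data.Vec as Vec using (Vec; []; _∷_; replicate; lookup)
open import Data.Vec.Properties using (lookup-replicate)
open import Data.Vec.Relation.Unary.All using ([]; _∷_) renaming (All to Allᵛ)
import Data.Vec.Relation.Unary.All.Properties as Allᵛₚ
open import Data.Integer as ℤ using (ℤ; +[1+_]; -[1+_]; 0ℤ; 1ℤ; -1ℤ)
import Data.Integer.Properties as ℤP
open import Data.List.Membership.Propositional using (_∈_)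
open import Data.List.Membership.Propositional.Properties using (∈-filter⁺; ∈-map⁺; ∈-++⁺ˡ; ∈-++⁺ʳ)
open import Data.Product using (Σ; ∃-syntax; _×_; _,_; proj₁)
open import Data.Sum using (_⊎_; inj₁; inj₂)
open import Relation.Binary.PropositionalEquality
open import Relation.Nullary using (¬_; yes; no; ¬?)
open import Relation.Nullary.Decidable using (T?; does; dec-true; dec-false)
open import Relation.Unary using (Decidable)
open import Relation.Binary.Definitions using (tri<; tri≈; tri>)
open import Function.Base using (_∘_; id)
open import Data.Empty using (⊥-elim)
open import Data.Nat.Tactic.RingSolver using (solve-∀)

private
  variable
    A B : Set

∑ : List A → (A → ℕ) → ℕ
∑ []       f = 0
∑ (x ∷ xs) f = f x + ∑ xs f

syntax ∑ xs (λ x → e) = ∑[ x ∈ xs ] e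

⟦_⟧ : Bool → ℕ
⟦ true  ⟧ = 1
⟦ false ⟧ = 0

∑-zero : ∀ (xs : List A) → ∑[ x ∈ xs ] 0 ≡ 0
∑-zero []       = refl
∑-zero (x ∷ xs) = ∑-zero xs

∑-const : ∀ (xs : List A) c → ∑[ x ∈ xs ] c ≡ length xs * c
∑-const []       c = refl
∑-const (x ∷ xs) c = cong (c +_) (∑-const xs c)

∑-+ : ∀ (xs : List A) f g → ∑[ x ∈ xs ] (f x + g x) ≡ ∑ xs f + ∑ xs g
∑-+ []       f g = refl
∑-+ (x ∷ xs) f g = trans (cong (f x + g x +_) (∑-+ xs f g)) (+-+-comm (f x) (g x) _ _)
  where
    +-+-comm : ∀ a b c d → a + b + (c + d) ≡ a + c + (b + d)
    +-+-comm = solve-∀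

∑-*ˡ : ∀ (xs : List A) c f → ∑[ x ∈ xs ] (c * f x) ≡ c * ∑ xs f
∑-*ˡ []       c f = sym (*-zeroʳ c)
∑-*ˡ (x ∷ xs) c f = trans (cong (c * f x +_) (∑-*ˡ xs c f)) (sym (*-distribˡ-+ c (f x) _))

∑-++ : ∀ (xs ys : List A) f → ∑ (xs ++ ys) f ≡ ∑ xs f + ∑ ys f
∑-++ []       ys f = refl
∑-++ (x ∷ xs) ys f = trans (cong (f x +_) (∑-++ xs ys f)) (sym (+-assoc (f x) _ _))

∑-mono : ∀ {P : A → Set} {xs : List A} {f g : A → ℕ} →
         All P xs → (∀ {x} → P x → f x ≤ g x) → ∑ xs f ≤ ∑ xs g
∑-mono []         f≤g = z≤n
∑-mono (px ∷ pxs) f≤g = +-mono-≤ (f≤g px) (∑-mono pxs f≤g)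

∑-map : ∀ (g : A → B) (xs : List A) f → ∑ (map g xs) f ≡ ∑[ x ∈ xs ] f (g x)
∑-map g []       f = refl
∑-map g (x ∷ xs) f = cong (f (g x) +_) (∑-map g xs f)

∑-comm : ∀ (xs : List A) (ys : List B) (f : A → B → ℕ) →
         ∑[ x ∈ xs ] ∑[ y ∈ ys ] f x y ≡ ∑[ y ∈ ys ] ∑[ x ∈ xs ] f x y
∑-comm []       ys f = sym (∑-zero ys)
∑-comm (x ∷ xs) ys f = trans (cong (∑ ys (f x) +_) (∑-comm xs ys f)) (sym (∑-+ ys (f x) _))

∃-≥-average : ∀ (xs : List A) f c → 0 < length xs → length xs * c ≤ ∑ xs f → ∃[ x ] c ≤ f x
∃-≥-average (x ∷ xs) f c _ ≤∑ with c ≤? f x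
... | yes c≤fx = x , c≤fx
∃-≥-average (x ∷ []) f c _ ≤∑ | no c≰fx =
  ⊥-elim (c≰fx (subst₂ _≤_ (+-identityʳ c) (+-identityʳ (f x)) ≤∑))
∃-≥-average (x ∷ xs@(_ ∷ _)) f c _ ≤∑ | no c≰fx =
  ∃-≥-average xs f c z<s (+-cancelˡ-≤ (f x) _ _ (≤-trans (+-monoˡ-≤ _ fx≤c) ≤∑))
  where
    fx≤c : f x ≤ c
    fx≤c = <⇒≤ (≰⇒> c≰fx)

-- Greedy covering

module GreedyCover {Test X : Set} (hit : Test → X → Bool) (tests : List Test) (d : ℕ) where

  hits : Test → List X → ℕ
  hits t L = ∑[ x ∈ L ] ⟦ hit t x ⟧

  Dense : X → Set
  Dense x = length tests ≤ suc d * ∑[ t ∈ tests ] ⟦ hit t x ⟧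

  missed? : ∀ t → Decidable (λ x → ¬ T (hit t x))
  missed? t x = ¬? (T? (hit t x))

  misses : Test → List X → List X
  misses t = filter (missed? t)

  Covered : List Test → X → Set
  Covered ts x = Any (λ t → T (hit t x)) ts

  length-misses : ∀ t L → length (misses t L) + hits t L ≡ length L
  length-misses t []      = refl
  length-misses t (x ∷ L) with hit t x
  ... | true  = trans (+-suc _ _) (cong suc (length-misses t L))
  ... | false = cong suc (length-misses t L)

  some-test-hits-a-share : 0 < length tests → ∀ {L} → All Dense L → ∃[ t ] length L ≤ suc d * hits t L
  some-test-hits-a-share nonempty {L} dense =
    ∃-≥-average tests (λ t → suc d * hits t L) (length L) nonempty double-count
    where
      open ≤-Reasoning
      double-count : length tests * length L ≤ ∑[ t ∈ tests ] (suc d * hits t L)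
      double-count = begin
        length tests * length L                           ≡⟨ *-comm (length tests) (length L) ⟩
        length L * length tests                           ≡⟨ ∑-const L (length tests) ⟨
        ∑[ x ∈ L ] length tests                           ≤⟨ ∑-mono dense id ⟩
        ∑[ x ∈ L ] (suc d * ∑[ t ∈ tests ] ⟦ hit t x ⟧)   ≡⟨ ∑-*ˡ L (suc d) _ ⟩
        suc d * ∑[ x ∈ L ] ∑[ t ∈ tests ] ⟦ hit t x ⟧     ≡⟨ cong (suc d *_) (∑-comm L tests _) ⟩
        suc d * ∑[ t ∈ tests ] hits t L                   ≡⟨ ∑-*ˡ tests (suc d) _ ⟨
        ∑[ t ∈ tests ] (suc d * hits t L)                 ∎

  some-test-shrinks : 0 < length tests → ∀ {L} → All Dense L →
                      ∃[ t ] suc d * length (misses t L) ≤ d * length L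
  some-test-shrinks nonempty {L} dense with some-test-hits-a-share nonempty dense
  ... | t , share = t , +-cancelʳ-≤ (length L) _ _ (begin
    suc d * length (misses t L) + length L               ≤⟨ +-monoʳ-≤ _ share ⟩
    suc d * length (misses t L) + suc d * hits t L       ≡⟨ *-distribˡ-+ (suc d) (length (misses t L)) (hits t L) ⟨
    suc d * (length (misses t L) + hits t L)             ≡⟨ cong (suc d *_) (length-misses t L) ⟩
    suc d * length L                                     ≡⟨ +-comm (length L) (d * length L) ⟩
    d * length L + length L                              ∎)
    where open ≤-Reasoning

  extend-cover : ∀ {ts} t L → All (Covered ts) (misses t L) → All (Covered (t ∷ ts)) L
  extend-cover {ts} t L covers = All.tabulate covered
    where
      covered : ∀ {x} → x ∈ L → Covered (t ∷ ts) x
      covered {x} x∈L with T? (hit t x)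
      ... | yes hx = here hx
      ... | no ¬hx = there (All.lookup covers (∈-filter⁺ (missed? t) x∈L ¬hx))

  shrinking-keeps-small : ∀ r {m l} → suc d * m ≤ d * l → d ^ suc r * l < suc d ^ suc r → d ^ r * m < suc d ^ r
  shrinking-keeps-small r {m} {l} shrinks small = *-cancelˡ-< (suc d) _ _ (begin-strict
    suc d * (d ^ r * m)   ≡⟨ *-left-comm (suc d) (d ^ r) m ⟩
    d ^ r * (suc d * m)   ≤⟨ *-monoʳ-≤ (d ^ r) shrinks ⟩
    d ^ r * (d * l)       ≡⟨ *-left-comm (d ^ r) d l ⟩
    d * (d ^ r * l)       ≡⟨ *-assoc d (d ^ r) l ⟨
    d ^ suc r * l         <⟨ small ⟩
    suc d ^ suc r         ∎)
    where
      open ≤-Reasoning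
      *-left-comm : ∀ a b c → a * (b * c) ≡ b * (a * c)
      *-left-comm = solve-∀

  greedy-cover : 0 < length tests → ∀ r L → All Dense L → d ^ r * length L < suc d ^ r →
                 ∃[ ts ] length ts ≤ r × All (Covered ts) L
  greedy-cover _        r       []         _     _             = [] , z≤n , []
  greedy-cover _        zero    (_ ∷ _)    _     (s≤s ())
  greedy-cover nonempty (suc r) L@(_ ∷ _) dense small =
    let t , shrinks       = some-test-shrinks nonempty dense
        ts , ts≤r , covers = greedy-cover nonempty r (misses t L) (filter⁺ (missed? t) dense)
                               (shrinking-keeps-small r shrinks small)
    in t ∷ ts , s≤s ts≤r , extend-cover t L covers

cover⇒colouring : ∀ (G : Graph) {Class : Set} (In : Class → V G → Set) (cs : List Class) →
                  (∀ c {u v} → In c u → In c v → ¬ Adj G u v) →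
                  (∀ v → Any (λ c → In c v) cs) → Colouring G (length cs)
cover⇒colouring G In cs independent covered = (λ v → index (covered v)) , proper
  where
    proper : ∀ u v → Adj G u v → index (covered u) ≢ index (covered v)
    proper u v uv same = independent (List.lookup cs (index (covered v)))
      (subst (λ i → In (List.lookup cs i) u) same (lookup-index (covered u)))
      (lookup-index (covered v)) uv

shift-graph-bound : ∀ (G : Graph) {m k} (X : (i j : Fin m) → i Fin.< j → V G) →
                    (∀ {i j l} (i<j : i Fin.< j) (j<l : j Fin.< l) → Adj G (X i j i<j) (X j l j<l)) →
                    Colouring G k → m ≤ 2 ^ k
shift-graph-bound G {m} {k} X adjacent (f , proper) = injective⇒≤ {f = code} code-injective
  where
    colour : (i j : Fin m) → i Fin.< j → Fin k
    colour i j i<j = f (X i j i<j)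

    ColourLeaves : Fin m → Fin k → Fin m → Set
    ColourLeaves i c j = Σ (i Fin.< j) λ i<j → colour i j i<j ≡ c

    colourLeaves? : ∀ i c → Decidable (ColourLeaves i c)
    colourLeaves? i c j with i Finₚ.<? j
    ... | no  i≮j = no (i≮j ∘ proj₁)
    ... | yes i<j with colour i j i<j Finₚ.≟ c
    ...   | yes same = yes (i<j , same)
    ...   | no  diff = no λ (i<j′ , same) →
      diff (trans (cong (colour i j) (Finₚ.<-irrelevant i<j i<j′)) same)

    outColours : Fin m → Fin k → Bool
    outColours i c = does (any? (colourLeaves? i c))

    bit : Bool → Fin 2
    bit b = if b then suc zero else zero

    code : Fin m → Fin (2 ^ k)
    code i = funToFin (bit ∘ outColours i)

    own-colour-leaves : ∀ {i j} (i<j : i Fin.< j) → outColours i (colour i j i<j) ≡ true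
    own-colour-leaves {j = j} i<j = dec-true (any? (colourLeaves? _ _)) (j , i<j , refl)

    own-colour-not-leaves-next : ∀ {i j} (i<j : i Fin.< j) → outColours j (colour i j i<j) ≡ false
    own-colour-not-leaves-next i<j = dec-false (any? (colourLeaves? _ _))
      λ (_ , j<l , same) → proper _ _ (adjacent i<j j<l) (sym same)

    code-separates : ∀ {i j} → i Fin.< j → code i ≢ code j
    code-separates {i} {j} i<j same = Finₚ.0≢1+n (sym (begin
      bit true                        ≡⟨ cong bit (own-colour-leaves i<j) ⟨
      bit (outColours i c)            ≡⟨ finToFun-funToFin (bit ∘ outColours i) c ⟨
      finToFun (code i) c             ≡⟨ cong (λ x → finToFun x c) same ⟩
      finToFun (code j) c             ≡⟨ finToFun-funToFin (bit ∘ outColours j) c ⟩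
      bit (outColours j c)            ≡⟨ cong bit (own-colour-not-leaves-next i<j) ⟩
      bit false                       ∎))
      where
        open ≡-Reasoning
        c : Fin k
        c = colour i j i<j

    code-injective : ∀ {i j} → code i ≡ code j → i ≡ j
    code-injective {i} {j} same with Finₚ.<-cmp i j
    ... | tri< i<j _   _   = ⊥-elim (code-separates i<j same)
    ... | tri≈ _   i≡j _   = i≡j
    ... | tri> _   _   j<i = ⊥-elim (code-separates j<i (sym same))

-- Sign agreement

cube : ∀ n → List (Vec Bool n)
cube zero    = [] ∷ []
cube (suc n) = map (true ∷_) (cube n) ++ map (false ∷_) (cube n)

length-cube : ∀ n → length (cube n) ≡ 2 ^ n
length-cube zero    = refl
length-cube (suc n) = begin
  length (map (true ∷_) (cube n) ++ map (false ∷_) (cube n))  ≡⟨ length-++ (map (true ∷_) (cube n)) ⟩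
  length (map (true ∷_) (cube n)) + length (map (false ∷_) (cube n))
    ≡⟨ cong₂ _+_ (length-map (true ∷_) (cube n)) (length-map (false ∷_) (cube n)) ⟩
  length (cube n) + length (cube n)                            ≡⟨ cong (λ l → l + l) (length-cube n) ⟩
  2 ^ n + 2 ^ n                                                ≡⟨ cong (2 ^ n +_) (+-identityʳ (2 ^ n)) ⟨
  2 ^ suc n                                                    ∎
  where open ≡-Reasoning

fits : Bool → ℤ → Bool
fits b +[1+ 0 ] = b
fits b -[1+ 0 ] = not b
fits b _        = true

agrees : ∀ {n} → Vec Bool n → Vec ℤ n → Bool
agrees []      []      = true
agrees (b ∷ h) (x ∷ v) = fits b x ∧ agrees h v

agreements : ∀ {n} → Vec ℤ n → ℕ
agreements {n} v = ∑[ h ∈ cube n ] ⟦ agrees h v ⟧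

agreements-∷ : ∀ {n} x (v : Vec ℤ n) →
  agreements (x ∷ v) ≡
  ∑[ h ∈ cube n ] ⟦ fits true x ∧ agrees h v ⟧ + ∑[ h ∈ cube n ] ⟦ fits false x ∧ agrees h v ⟧
agreements-∷ {n} x v = trans (∑-++ (map (true ∷_) (cube n)) _ _)
  (cong₂ _+_ (∑-map (true ∷_) (cube n) _) (∑-map (false ∷_) (cube n) _))

agreements-1∷ : ∀ {n} (v : Vec ℤ n) → agreements (1ℤ ∷ v) ≡ agreements v
agreements-1∷ {n} v =
  trans (agreements-∷ 1ℤ v) (trans (cong (agreements v +_) (∑-zero (cube n))) (+-identityʳ _))

agreements-[-1]∷ : ∀ {n} (v : Vec ℤ n) → agreements (-1ℤ ∷ v) ≡ agreements v
agreements-[-1]∷ {n} v = trans (agreements-∷ -1ℤ v) (cong (_+ agreements v) (∑-zero (cube n)))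

2^nnz*agreements≡2^n : ∀ {n} {v : Vec ℤ n} → Allᵛ Ternary v → 2 ^ nnz v * agreements v ≡ 2 ^ n
2^nnz*agreements≡2^n                 []                      = refl
2^nnz*agreements≡2^n {suc n} {_ ∷ v} (inj₂ (inj₁ refl) ∷ t) = begin
  2 ^ nnz v * agreements (0ℤ ∷ v)                      ≡⟨ cong (2 ^ nnz v *_) (agreements-∷ 0ℤ v) ⟩
  2 ^ nnz v * (agreements v + agreements v)            ≡⟨ *-distribˡ-+ (2 ^ nnz v) _ _ ⟩
  2 ^ nnz v * agreements v + 2 ^ nnz v * agreements v ≡⟨ cong (λ a → a + a) (2^nnz*agreements≡2^n t) ⟩
  2 ^ n + 2 ^ n                                        ≡⟨ cong (2 ^ n +_) (+-identityʳ (2 ^ n)) ⟨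
  2 ^ suc n                                            ∎
  where open ≡-Reasoning
2^nnz*agreements≡2^n {suc n} {_ ∷ v} (inj₂ (inj₂ refl) ∷ t) = begin
  2 * 2 ^ nnz v * agreements (1ℤ ∷ v)  ≡⟨ cong (2 * 2 ^ nnz v *_) (agreements-1∷ v) ⟩
  2 * 2 ^ nnz v * agreements v         ≡⟨ *-assoc 2 (2 ^ nnz v) _ ⟩
  2 * (2 ^ nnz v * agreements v)       ≡⟨ cong (2 *_) (2^nnz*agreements≡2^n t) ⟩
  2 ^ suc n                            ∎
  where open ≡-Reasoning
2^nnz*agreements≡2^n {suc n} {_ ∷ v} (inj₁ refl ∷ t) = begin
  2 * 2 ^ nnz v * agreements (-1ℤ ∷ v)  ≡⟨ cong (2 * 2 ^ nnz v *_) (agreements-[-1]∷ v) ⟩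
  2 * 2 ^ nnz v * agreements v          ≡⟨ *-assoc 2 (2 ^ nnz v) _ ⟩
  2 * (2 ^ nnz v * agreements v)        ≡⟨ cong (2 *_) (2^nnz*agreements≡2^n t) ⟩
  2 ^ suc n                             ∎
  where open ≡-Reasoning

sign : Bool → ℤ
sign true  = 1ℤ
sign false = -1ℤ

fits⇒0∨sign : ∀ b {x} → Ternary x → T (fits b x) → x ≡ 0ℤ ⊎ x ≡ sign b
fits⇒0∨sign _     (inj₂ (inj₁ refl)) _  = inj₁ refl
fits⇒0∨sign true  (inj₂ (inj₂ refl)) _  = inj₂ refl
fits⇒0∨sign false (inj₁ refl)        _  = inj₂ refl
fits⇒0∨sign true  (inj₁ refl)        ()
fits⇒0∨sign false (inj₂ (inj₂ refl)) ()

fits⇒*-nonneg : ∀ b {x y} → Ternary x → Ternary y → T (fits b x) → T (fits b y) → 0ℤ ℤ.≤ x ℤ.* y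
fits⇒*-nonneg b tx ty fx fy with fits⇒0∨sign b tx fx | fits⇒0∨sign b ty fy
... | inj₁ refl | _         = ℤ.+≤+ z≤n
... | inj₂ refl | inj₁ refl = ℤP.≤-reflexive (sym (ℤP.*-zeroʳ (sign b)))
... | inj₂ refl | inj₂ refl = sign*sign-nonneg b
  where
    sign*sign-nonneg : ∀ b → 0ℤ ℤ.≤ sign b ℤ.* sign b
    sign*sign-nonneg true  = ℤ.+≤+ z≤n
    sign*sign-nonneg false = ℤ.+≤+ z≤n

agrees⇒dot-nonneg : ∀ {n} (h : Vec Bool n) {u w} → Allᵛ Ternary u → Allᵛ Ternary w →
                    T (agrees h u) → T (agrees h w) → 0ℤ ℤ.≤ dot u w
agrees⇒dot-nonneg []      []        []        _  _  = ℤ.+≤+ z≤n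
agrees⇒dot-nonneg (b ∷ h) (tx ∷ tu) (ty ∷ tw) au aw
  with fx , au′ ← Equivalence.to T-∧ au
     | fy , aw′ ← Equivalence.to T-∧ aw
  = ℤP.+-mono-≤ (fits⇒*-nonneg b tx ty fx fy) (agrees⇒dot-nonneg h tu tw au′ aw′)

agreement-class-independent : ∀ {n} (h : Vec Bool n) {u w : JVertex n} →
  T (agrees h (proj₁ u)) → T (agrees h (proj₁ w)) → ¬ Adj (J± n) u w
agreement-class-independent h {_ , tu , _} {_ , tw , _} au aw uw =
  ℤP.<⇒≱ ℤ.-<+ (subst (0ℤ ℤ.≤_) uw (agrees⇒dot-nonneg h tu tw au aw))

OfWeight : ∀ {n} → ℕ → Vec ℤ n → Set
OfWeight k v = Allᵛ Ternary v × nnz v ≡ k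

ternaryVecs : (n k : ℕ) → List (Vec ℤ n)
signedHeads : (n k : ℕ) → List (Vec ℤ (suc n))

ternaryVecs zero    zero    = [] ∷ []
ternaryVecs zero    (suc k) = []
ternaryVecs (suc n) k       = map (0ℤ ∷_) (ternaryVecs n k) ++ signedHeads n k

signedHeads n zero    = []
signedHeads n (suc k) = map (1ℤ ∷_) (ternaryVecs n k) ++ map (-1ℤ ∷_) (ternaryVecs n k)

ternaryVecs-sound : ∀ n k → All (OfWeight k) (ternaryVecs n k)
signedHeads-sound : ∀ n k → All (OfWeight k) (signedHeads n k)

ternaryVecs-sound zero    zero    = ([] , refl) ∷ []
ternaryVecs-sound zero    (suc k) = []
ternaryVecs-sound (suc n) k       =
  ++⁺ (map⁺ (All.map (λ (t , w) → inj₂ (inj₁ refl) ∷ t , w) (ternaryVecs-sound n k)))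
      (signedHeads-sound n k)

signedHeads-sound n zero    = []
signedHeads-sound n (suc k) =
  ++⁺ (map⁺ (All.map (λ (t , w) → inj₂ (inj₂ refl) ∷ t , cong suc w) (ternaryVecs-sound n k)))
      (map⁺ (All.map (λ (t , w) → inj₁ refl ∷ t , cong suc w) (ternaryVecs-sound n k)))

ternaryVecs-complete : ∀ {n} {v : Vec ℤ n} → Allᵛ Ternary v → v ∈ ternaryVecs n (nnz v)
ternaryVecs-complete []                      = here refl
ternaryVecs-complete (inj₂ (inj₁ refl) ∷ t) = ∈-++⁺ˡ (∈-map⁺ (0ℤ ∷_) (ternaryVecs-complete t))
ternaryVecs-complete (inj₂ (inj₂ refl) ∷ t) =
  ∈-++⁺ʳ (map (0ℤ ∷_) (ternaryVecs _ _)) (∈-++⁺ˡ (∈-map⁺ (1ℤ ∷_) (ternaryVecs-complete t)))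
ternaryVecs-complete (inj₁ refl ∷ t)        =
  ∈-++⁺ʳ (map (0ℤ ∷_) (ternaryVecs _ _)) (∈-++⁺ʳ (map (1ℤ ∷_) (ternaryVecs _ _))
    (∈-map⁺ (-1ℤ ∷_) (ternaryVecs-complete t)))

length-ternaryVecs : ∀ n k → length (ternaryVecs n k) ≤ (2 * n) ^ k
length-ternaryVecs zero    zero    = ≤-refl
length-ternaryVecs zero    (suc k) = z≤n
length-ternaryVecs (suc n) k       = begin
  length (map (0ℤ ∷_) (ternaryVecs n k) ++ signedHeads n k)
    ≡⟨ trans (length-++ (map (0ℤ ∷_) (ternaryVecs n k)))
             (cong (_+ length (signedHeads n k)) (length-map (0ℤ ∷_) (ternaryVecs n k))) ⟩
  length (ternaryVecs n k) + length (signedHeads n k)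
    ≤⟨ +-monoˡ-≤ (length (signedHeads n k)) (length-ternaryVecs n k) ⟩
  (2 * n) ^ k + length (signedHeads n k)               ≤⟨ heads k ⟩
  (2 * suc n) ^ k                                      ∎
  where
    open ≤-Reasoning
    heads : ∀ k → (2 * n) ^ k + length (signedHeads n k) ≤ (2 * suc n) ^ k
    heads zero    = ≤-refl
    heads (suc k) = begin
      (2 * n) ^ suc k + length (map (1ℤ ∷_) (ternaryVecs n k) ++ map (-1ℤ ∷_) (ternaryVecs n k))
        ≡⟨ cong ((2 * n) ^ suc k +_) (trans (length-++ (map (1ℤ ∷_) (ternaryVecs n k)))
             (cong₂ _+_ (length-map (1ℤ ∷_) (ternaryVecs n k)) (length-map (-1ℤ ∷_) (ternaryVecs n k)))) ⟩
      (2 * n) ^ suc k + (length (ternaryVecs n k) + length (ternaryVecs n k))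
        ≤⟨ +-monoʳ-≤ ((2 * n) ^ suc k) (+-mono-≤ (length-ternaryVecs n k) (length-ternaryVecs n k)) ⟩
      (2 * n) * (2 * n) ^ k + ((2 * n) ^ k + (2 * n) ^ k)  ≡⟨ factor n ((2 * n) ^ k) ⟩
      (2 * suc n) * (2 * n) ^ k
        ≤⟨ *-monoʳ-≤ (2 * suc n) (^-monoˡ-≤ k (*-monoʳ-≤ 2 (n≤1+n n))) ⟩
      (2 * suc n) ^ suc k                                   ∎
      where
        factor : ∀ n b → (2 * n) * b + (b + b) ≡ (2 * suc n) * b
        factor = solve-∀

log₂-bracket : ∀ n → 0 < n → ∃[ ℓ ] 2 ^ ℓ ≤ n × n < 2 ^ suc ℓ
log₂-bracket (suc zero)    _ = 0 , ≤-refl , s≤s (s≤s z≤n)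
log₂-bracket (suc (suc m)) _ with log₂-bracket (suc m) z<s
... | ℓ , lo , hi with suc (suc m) <? 2 ^ suc ℓ
...   | yes below = ℓ , m≤n⇒m≤1+n lo , below
...   | no  ¬below = suc ℓ , ≤-reflexive (sym n≡2^[1+ℓ]) ,
                     subst (_< 2 ^ suc (suc ℓ)) (sym n≡2^[1+ℓ]) (^-monoʳ-< 2 (s≤s (s≤s z≤n)) (n<1+n (suc ℓ)))
  where
    n≡2^[1+ℓ] : suc (suc m) ≡ 2 ^ suc ℓ
    n≡2^[1+ℓ] = ≤-antisym hi (≮⇒≥ ¬below)

7^[t*6]*2^t≤8^[t*6] : ∀ t → 7 ^ (t * 6) * 2 ^ t ≤ 8 ^ (t * 6)
7^[t*6]*2^t≤8^[t*6] zero    = ≤-refl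
7^[t*6]*2^t≤8^[t*6] (suc t) = begin
  7 ^ (6 + t * 6) * (2 * 2 ^ t)        ≡⟨ cong (_* (2 * 2 ^ t)) (^-distribˡ-+-* 7 6 (t * 6)) ⟩
  7 ^ 6 * 7 ^ (t * 6) * (2 * 2 ^ t)    ≡⟨ regroup (7 ^ 6) (7 ^ (t * 6)) (2 ^ t) ⟩
  7 ^ 6 * 2 * (7 ^ (t * 6) * 2 ^ t)    ≤⟨ *-mono-≤ 7^6*2≤8^6 (7^[t*6]*2^t≤8^[t*6] t) ⟩
  8 ^ 6 * 8 ^ (t * 6)                  ≡⟨ ^-distribˡ-+-* 8 6 (t * 6) ⟨
  8 ^ (6 + t * 6)                      ∎
  where
    open ≤-Reasoning
    regroup : ∀ a b c → a * b * (2 * c) ≡ a * 2 * (b * c)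
    regroup = solve-∀
    7^6*2≤8^6 : 7 ^ 6 * 2 ≤ 8 ^ 6
    7^6*2≤8^6 = m≤m+n (7 ^ 6 * 2) 26846

7^[t*6]*N<8^[t*6] : ∀ t N → N < 2 ^ t → 7 ^ (t * 6) * N < 8 ^ (t * 6)
7^[t*6]*N<8^[t*6] t N N<2^t =
  <-≤-trans (*-monoʳ-< (7 ^ (t * 6)) {{m^n≢0 7 (t * 6)}} N<2^t) (7^[t*6]*2^t≤8^[t*6] t)

J±-colouring : ∀ n r → 7 ^ r * length (ternaryVecs n 3) < 8 ^ r → ∃[ k ] k ≤ r × Colouring (J± n) k
J±-colouring n r small =
  let ts , ts≤r , covers = greedy-cover cube-nonempty r (ternaryVecs n 3) (All.map dense (ternaryVecs-sound n 3)) small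
  in length ts , ts≤r ,
     cover⇒colouring (J± n) (λ h v → T (agrees h (proj₁ v))) ts agreement-class-independent
       λ (v , t , w) → All.lookup covers (subst (λ k → v ∈ ternaryVecs n k) w (ternaryVecs-complete t))
  where
    open GreedyCover agrees (cube n) 7
    cube-nonempty : 0 < length (cube n)
    cube-nonempty = subst (0 <_) (sym (length-cube n)) (m^n>0 2 n)
    dense : ∀ {v} → OfWeight 3 v → Dense v
    dense {v} (t , w) = ≤-reflexive (trans (length-cube n)
      (sym (subst (λ e → 2 ^ e * agreements v ≡ 2 ^ n) w (2^nnz*agreements≡2^n t))))

length-ternaryVecs-3<2^[[2+ℓ]*3] : ∀ n ℓ → n < 2 ^ suc ℓ → length (ternaryVecs n 3) < 2 ^ ((2 + ℓ) * 3)
length-ternaryVecs-3<2^[[2+ℓ]*3] n ℓ n<2^[1+ℓ] = begin-strict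
  length (ternaryVecs n 3)  ≤⟨ length-ternaryVecs n 3 ⟩
  (2 * n) ^ 3               <⟨ ^-monoˡ-< 3 (*-monoʳ-< 2 n<2^[1+ℓ]) ⟩
  (2 ^ (2 + ℓ)) ^ 3         ≡⟨ ^-*-assoc 2 (2 + ℓ) 3 ⟩
  2 ^ ((2 + ℓ) * 3)         ∎
  where open ≤-Reasoning

2^[[2+ℓ]*3*6]≤n^36 : ∀ n ℓ → 3 < n → 2 ^ ℓ ≤ n → 2 ^ ((2 + ℓ) * 3 * 6) ≤ n ^ 36
2^[[2+ℓ]*3*6]≤n^36 n ℓ 3<n 2^ℓ≤n = begin
  2 ^ ((2 + ℓ) * 3 * 6)      ≡⟨ ^-*-assoc 2 ((2 + ℓ) * 3) 6 ⟨
  (2 ^ ((2 + ℓ) * 3)) ^ 6    ≡⟨ cong (_^ 6) (^-*-assoc 2 (2 + ℓ) 3) ⟨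
  ((2 ^ (2 + ℓ)) ^ 3) ^ 6    ≤⟨ ^-monoˡ-≤ 6 (^-monoˡ-≤ 3 2^[2+ℓ]≤n^2) ⟩
  ((n ^ 2) ^ 3) ^ 6          ≡⟨ cong (_^ 6) (^-*-assoc n 2 3) ⟩
  (n ^ (2 * 3)) ^ 6          ≡⟨ ^-*-assoc n (2 * 3) 6 ⟩
  n ^ 36                     ∎
  where
    open ≤-Reasoning
    2^[2+ℓ]≤n^2 : 2 ^ (2 + ℓ) ≤ n ^ 2
    2^[2+ℓ]≤n^2 = begin
      2 ^ (2 + ℓ)    ≡⟨ ^-distribˡ-+-* 2 2 ℓ ⟩
      2 ^ 2 * 2 ^ ℓ  ≤⟨ *-mono-≤ 3<n 2^ℓ≤n ⟩
      n * n          ≡⟨ cong (n *_) (*-identityʳ n) ⟨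
      n ^ 2          ∎

χ-upper : ∀ n k → 3 < n → IsChromaticNumber (J± n) k → 2 ^ k ≤ n ^ 36
χ-upper n k 3<n (_ , minimal) =
  let ℓ , 2^ℓ≤n , n<2^[1+ℓ] = log₂-bracket n (<-trans z<s 3<n)
      c , c≤r , colouring    = J±-colouring n ((2 + ℓ) * 3 * 6)
        (7^[t*6]*N<8^[t*6] ((2 + ℓ) * 3) (length (ternaryVecs n 3)) (length-ternaryVecs-3<2^[[2+ℓ]*3] n ℓ n<2^[1+ℓ]))
  in through ((2 + ℓ) * 3 * 6) (≤-trans (minimal c colouring) c≤r) (2^[[2+ℓ]*3*6]≤n^36 n ℓ 3<n 2^ℓ≤n)
  where
    -- Keeps the exponent a variable: solving 2 ^ ?r ≟ 2 ^ ((2 + ℓ) * 3 * 6) would make Agda unfold the power.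
    through : ∀ r → k ≤ r → 2 ^ r ≤ n ^ 36 → 2 ^ k ≤ n ^ 36
    through r k≤r 2^r≤n^36 = ≤-trans (^-monoʳ-≤ 2 k≤r) 2^r≤n^36

-- Shift graph inside J±

δ : ∀ {m} → ℤ → Fin m → Vec ℤ m
δ {suc m} s zero    = s ∷ replicate m 0ℤ
δ         s (suc i) = 0ℤ ∷ δ s i

dipole : ∀ {m} → Fin m → Fin m → Vec ℤ m
dipole {suc m} zero    zero    = replicate (suc m) 0ℤ
dipole         zero    (suc j) = 1ℤ ∷ δ -1ℤ j
dipole         (suc i) zero    = -1ℤ ∷ δ 1ℤ i
dipole         (suc i) (suc j) = 0ℤ ∷ dipole i j

dot-++ : ∀ {a b} (u : Vec ℤ a) (v : Vec ℤ b) (u′ : Vec ℤ a) (v′ : Vec ℤ b) →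
         dot (u Vec.++ v) (u′ Vec.++ v′) ≡ dot u u′ ℤ.+ dot v v′
dot-++ []      v []       v′ = sym (ℤP.+-identityˡ _)
dot-++ (x ∷ u) v (y ∷ u′) v′ =
  trans (cong (ℤ._+_ (x ℤ.* y)) (dot-++ u v u′ v′)) (sym (ℤP.+-assoc (x ℤ.* y) _ _))

dot-zeroˡ : ∀ {m} (v : Vec ℤ m) → dot (replicate m 0ℤ) v ≡ 0ℤ
dot-zeroˡ []      = refl
dot-zeroˡ (x ∷ v) = trans (ℤP.+-identityˡ _) (dot-zeroˡ v)

dot-δ : ∀ {m} s (i : Fin m) v → dot (δ s i) v ≡ s ℤ.* lookup v i
dot-δ s zero    (x ∷ v) = trans (cong (ℤ._+_ (s ℤ.* x)) (dot-zeroˡ v)) (ℤP.+-identityʳ _)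
dot-δ s (suc i) (x ∷ v) = trans (ℤP.+-identityˡ _) (dot-δ s i v)

dot-dipole : ∀ {m} (i j : Fin m) v → dot (dipole i j) v ≡ lookup v i ℤ.- lookup v j
dot-dipole zero    zero    (x ∷ v) = trans (dot-zeroˡ (x ∷ v)) (sym (ℤP.+-inverseʳ x))
dot-dipole zero    (suc j) (x ∷ v) = cong₂ ℤ._+_ (ℤP.*-identityˡ x) (trans (dot-δ -1ℤ j v) (ℤP.-1*i≡-i _))
dot-dipole (suc i) zero    (x ∷ v) =
  trans (cong₂ ℤ._+_ (ℤP.-1*i≡-i x) (trans (dot-δ 1ℤ i v) (ℤP.*-identityˡ _))) (ℤP.+-comm (ℤ.- x) _)
dot-dipole (suc i) (suc j) (x ∷ v) = trans (ℤP.+-identityˡ _) (dot-dipole i j v)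

lookup-δ : ∀ {m} s (i : Fin m) → lookup (δ s i) i ≡ s
lookup-δ s zero    = refl
lookup-δ s (suc i) = lookup-δ s i

lookup-δ-≢ : ∀ {m} s {i j : Fin m} → i ≢ j → lookup (δ s i) j ≡ 0ℤ
lookup-δ-≢ s {zero}  {zero}  i≢j = ⊥-elim (i≢j refl)
lookup-δ-≢ s {zero}  {suc j} _   = lookup-replicate j 0ℤ
lookup-δ-≢ s {suc i} {zero}  _   = refl
lookup-δ-≢ s {suc i} {suc j} i≢j = lookup-δ-≢ s (i≢j ∘ cong suc)

lookup-dipole : ∀ {m} {i j : Fin m} → i ≢ j → lookup (dipole i j) i ≡ 1ℤ
lookup-dipole {i = zero}  {zero}  i≢j = ⊥-elim (i≢j refl)
lookup-dipole {i = zero}  {suc j} _   = refl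
lookup-dipole {i = suc i} {zero}  _   = lookup-δ 1ℤ i
lookup-dipole {i = suc i} {suc j} i≢j = lookup-dipole (i≢j ∘ cong suc)

lookup-dipole-≢ : ∀ {m} {i j k : Fin m} → i ≢ k → j ≢ k → lookup (dipole i j) k ≡ 0ℤ
lookup-dipole-≢ {i = zero}  {zero}  {k}     _   _   = lookup-replicate k 0ℤ
lookup-dipole-≢ {i = zero}  {suc j} {zero}  i≢k _   = ⊥-elim (i≢k refl)
lookup-dipole-≢ {i = zero}  {suc j} {suc k} _   j≢k = lookup-δ-≢ -1ℤ (j≢k ∘ cong suc)
lookup-dipole-≢ {i = suc i} {zero}  {zero}  _   j≢k = ⊥-elim (j≢k refl)
lookup-dipole-≢ {i = suc i} {zero}  {suc k} i≢k _   = lookup-δ-≢ 1ℤ (i≢k ∘ cong suc)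
lookup-dipole-≢ {i = suc i} {suc j} {zero}  _   _   = refl
lookup-dipole-≢ {i = suc i} {suc j} {suc k} i≢k j≢k = lookup-dipole-≢ (i≢k ∘ cong suc) (j≢k ∘ cong suc)

nnz-++ : ∀ {a b} (u : Vec ℤ a) (v : Vec ℤ b) → nnz (u Vec.++ v) ≡ nnz u + nnz v
nnz-++ []      v = refl
nnz-++ (x ∷ u) v rewrite nnz-++ u v = sym (+-assoc _ (nnz u) (nnz v))

nnz-replicate-0 : ∀ m → nnz (replicate m 0ℤ) ≡ 0
nnz-replicate-0 zero    = refl
nnz-replicate-0 (suc m) = nnz-replicate-0 m

nnz-δ : ∀ {m} s (i : Fin m) → nnz (δ s i) ≡ nnz (s ∷ [])
nnz-δ {suc m} s zero    = trans (nnz-++ (s ∷ []) (replicate m 0ℤ))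
                                (trans (cong (nnz (s ∷ []) +_) (nnz-replicate-0 m)) (+-identityʳ _))
nnz-δ         s (suc i) = nnz-δ s i

nnz-dipole : ∀ {m} {i j : Fin m} → i ≢ j → nnz (dipole i j) ≡ 2
nnz-dipole {i = zero}  {zero}  i≢j = ⊥-elim (i≢j refl)
nnz-dipole {i = zero}  {suc j} _   = cong suc (nnz-δ -1ℤ j)
nnz-dipole {i = suc i} {zero}  _   = cong suc (nnz-δ 1ℤ i)
nnz-dipole {i = suc i} {suc j} i≢j = nnz-dipole (i≢j ∘ cong suc)

ternary-replicate-0 : ∀ m → Allᵛ Ternary (replicate m 0ℤ)
ternary-replicate-0 zero    = []
ternary-replicate-0 (suc m) = inj₂ (inj₁ refl) ∷ ternary-replicate-0 m

ternary-δ : ∀ {m s} → Ternary s → (i : Fin m) → Allᵛ Ternary (δ s i)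
ternary-δ {suc m} t zero    = t ∷ ternary-replicate-0 m
ternary-δ         t (suc i) = inj₂ (inj₁ refl) ∷ ternary-δ t i

ternary-dipole : ∀ {m} (i j : Fin m) → Allᵛ Ternary (dipole i j)
ternary-dipole {suc m} zero    zero    = ternary-replicate-0 (suc m)
ternary-dipole         zero    (suc j) = inj₂ (inj₂ refl) ∷ ternary-δ (inj₁ refl) j
ternary-dipole         (suc i) zero    = inj₁ refl ∷ ternary-δ (inj₂ (inj₂ refl)) i
ternary-dipole         (suc i) (suc j) = inj₂ (inj₁ refl) ∷ ternary-dipole i j

shiftVertex : ∀ {m} r (i j : Fin m) → i Fin.< j → JVertex (m + (m + r))
shiftVertex r i j i<j =
  dipole i j Vec.++ δ 1ℤ (j ↑ˡ r) ,
  Allᵛₚ.++⁺ (ternary-dipole i j) (ternary-δ (inj₂ (inj₂ refl)) (j ↑ˡ r)) ,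
  trans (nnz-++ (dipole i j) (δ 1ℤ (j ↑ˡ r))) (cong₂ _+_ (nnz-dipole (Finₚ.<⇒≢ i<j)) (nnz-δ 1ℤ (j ↑ˡ r)))

shiftVertex-adjacent : ∀ {m} r {i j l : Fin m} (i<j : i Fin.< j) (j<l : j Fin.< l) →
                       Adj (J± (m + (m + r))) (shiftVertex r i j i<j) (shiftVertex r j l j<l)
shiftVertex-adjacent r {i} {j} {l} i<j j<l = begin
  dot (dipole i j Vec.++ δ 1ℤ (j ↑ˡ r)) (dipole j l Vec.++ δ 1ℤ (l ↑ˡ r))
    ≡⟨ dot-++ (dipole i j) (δ 1ℤ (j ↑ˡ r)) (dipole j l) (δ 1ℤ (l ↑ˡ r)) ⟩
  dot (dipole i j) (dipole j l) ℤ.+ dot (δ 1ℤ (j ↑ˡ r)) (δ 1ℤ (l ↑ˡ r))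
    ≡⟨ cong₂ ℤ._+_ (dot-dipole i j (dipole j l)) (dot-δ 1ℤ (j ↑ˡ r) (δ 1ℤ (l ↑ˡ r))) ⟩
  (lookup (dipole j l) i ℤ.- lookup (dipole j l) j) ℤ.+ 1ℤ ℤ.* lookup (δ 1ℤ (l ↑ˡ r)) (j ↑ˡ r)
    ≡⟨ cong₂ ℤ._+_ (cong₂ ℤ._-_ (lookup-dipole-≢ (≢-sym i≢j) (≢-sym i≢l)) (lookup-dipole j≢l))
                   (cong (1ℤ ℤ.*_) (lookup-δ-≢ 1ℤ (≢-sym j≢l ∘ Finₚ.↑ˡ-injective r l j))) ⟩
  (0ℤ ℤ.- 1ℤ) ℤ.+ 1ℤ ℤ.* 0ℤ
    ≡⟨⟩
  -1ℤ ∎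
  where
    open ≡-Reasoning
    i≢j : i ≢ j
    i≢j = Finₚ.<⇒≢ i<j
    j≢l : j ≢ l
    j≢l = Finₚ.<⇒≢ j<l
    i≢l : i ≢ l
    i≢l = Finₚ.<⇒≢ (Finₚ.<-trans i<j j<l)

halves : ∀ n → ∃[ m ] ∃[ r ] r ≤ 1 × n ≡ m + (m + r)
halves zero          = 0 , 0 , z≤n , refl
halves (suc zero)    = 0 , 1 , ≤-refl , refl
halves (suc (suc n)) =
  let m , r , r≤1 , n≡m+[m+r] = halves n
  in suc m , r , r≤1 , cong suc (trans (cong suc n≡m+[m+r]) (sym (+-suc m (m + r))))

m+[m+r]≤2^[3*k] : ∀ {m r} k → r ≤ 1 → 3 < m + (m + r) → m ≤ 2 ^ k → m + (m + r) ≤ 2 ^ (3 * k)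
m+[m+r]≤2^[3*k] zero    r≤1 3<n m≤1 = ⊥-elim (<⇒≱ 3<n (+-mono-≤ m≤1 (+-mono-≤ m≤1 r≤1)))
m+[m+r]≤2^[3*k] {m} {r} (suc k) r≤1 _ m≤2^K = begin
  m + (m + r)
    ≤⟨ +-mono-≤ m≤2^K (+-mono-≤ m≤2^K (≤-trans r≤1 (m^n>0 2 (suc k)))) ⟩
  2 ^ suc k + (2 ^ suc k + 2 ^ suc k)        ≤⟨ m≤m+n _ (2 ^ suc k) ⟩
  2 ^ suc k + (2 ^ suc k + 2 ^ suc k) + 2 ^ suc k  ≡⟨ four-times (2 ^ suc k) ⟩
  2 ^ 2 * 2 ^ suc k                          ≡⟨ ^-distribˡ-+-* 2 2 (suc k) ⟨
  2 ^ (2 + suc k)                            ≤⟨ ^-monoʳ-≤ 2 2+K≤3*K ⟩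
  2 ^ (3 * suc k)                            ∎
  where
    open ≤-Reasoning
    four-times : ∀ a → a + (a + a) + a ≡ 4 * a
    four-times = solve-∀
    2+K≤3*K : 2 + suc k ≤ 3 * suc k
    2+K≤3*K = ≤-trans (≤-reflexive (+-comm 2 (suc k))) (+-monoʳ-≤ (suc k) (+-mono-≤ (s≤s z≤n) (s≤s z≤n)))

χ-lower : ∀ n k → 3 < n → Colouring (J± n) k → n ≤ 2 ^ (3 * k)
χ-lower n k 3<n colouring =
  let m , r , r≤1 , n≡m+[m+r] = halves n
      m≤2^k = shift-graph-bound (J± (m + (m + r))) (shiftVertex {m} r) (shiftVertex-adjacent {m} r)
                (subst (λ n → Colouring (J± n) k) n≡m+[m+r] colouring)
  in subst (_≤ 2 ^ (3 * k)) (sym n≡m+[m+r]) (m+[m+r]≤2^[3*k] k r≤1 (subst (3 <_) n≡m+[m+r] 3<n) m≤2^k)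

theorem2 : Σ ℕ λ a → Σ ℕ λ b → 0 < a × 0 < b ×
             (∀ n → 3 < n → ∀ k → IsChromaticNumber (J± n) k →
               (n ≤ 2 ^ (a * k)) × (2 ^ k ≤ n ^ b))
theorem2 = 3 , 36 , z<s , z<s , λ n 3<n k χ → χ-lower n k 3<n (proj₁ χ) , χ-upper n k 3<n χ
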